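{- Let $n>0$ and let $a=(a_1,\dots,a_{m_1})$ and $\mu=(\mu_1,\dots,\mu_{m_2})$ be tuples of positive integers. Set $a_0=0$ and $\mu_0=1$. Then there exists a classical noncrossing partition $\pi$ for $A_{n-1}$ with $a(\pi)=a$ and $\mu(\pi)=\mu$ if and only if the following three conditions hold, and likewise there exists a classical nonnesting partition $\pi$ for $A_{n-1}$ with $a(\pi)=a$ and $\mu(\pi)=\mu$ if and only if they hold: (1) $m_1=m_2=m$; (2) $n=\sum_{k=1}^m\mu_k$; (3) $a_{i-1}<a_i\le\sum_{k=0}^{i-1}\mu_k$ for $i=1,\dots,m$.
   Context: A classical partition for $A_{n-1}$ is a set partition of $[n]=\{1,\dots,n\}$. For a set partition $P$ of the totally ordered set $1<2<\dots<n$, let $G(P)$ be the graph on $[n]$ with an edge $(s,s')$ whenever $s<s'$ lie in the same block and no element of that block lies strictly between them. $P$ is noncrossing if $G(P)$ has no two edges $(a,c),(b,d)$ with $a<b<c<d$, and nonnesting if $G(P)$ has no two edges $(a,d),(b,c)$ with $a<b<c<d$. For a partition $\pi$ of $[n]$ with blocks $M_1,\dots,M_m$ indexed so that their least elements $a_1<\dots<a_m$ increase, $a(\pi)=(a_1,\dots,a_m)$ and $\mu(\pi)=(|M_1|,\dots,|M_m|)$. -}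

module Defs where

open import Data.Nat using (ℕ; zero; suc; _+_; _<_; _≤_)
open import Data.Fin using (Fin; toℕ; inject₁)
open import Data.List using (List; []; _∷_; map; concat; concatMap; upTo; take; length; lookup)
open import Data.List.NonEmpty using (List⁺; toList) renaming (head to head⁺; length to length⁺)
open import Data.List.Relation.Unary.All using (All)
open import Data.List.Relation.Unary.Linked using (Linked)
open import Data.List.Relation.Binary.Permutation.Propositional using (_↭_)
open import Data.List.Membership.Propositional using (_∈_)
open import Data.Product using (_×_; _,_)
open import Data.Empty using (⊥)
open import Data.Nat.ListAction using (sum)
open import Relation.Binary.PropositionalEquality using (_≡_)

-- A set partition of [n] = {1,…,n}, in canonical form: a list of nonempty
-- blocks, each block listed strictly increasingly, blocks listed in order
-- of increasing least elements, and the blocks together contain every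
-- element of {1,…,n} exactly once.
Block : Set
Block = List⁺ ℕ

Partition : Set
Partition = List Block

range1 : ℕ → List ℕ
range1 n = map suc (upTo n)

IsSetPartition : ℕ → Partition → Set
IsSetPartition n P =
  All (λ B → Linked _<_ (toList B)) P
  × Linked (λ B C → head⁺ B < head⁺ C) P
  × (concat (map toList P) ↭ range1 n)

consecPairs : List ℕ → List (ℕ × ℕ)
consecPairs [] = []
consecPairs (x ∷ []) = []
consecPairs (x ∷ y ∷ r) = (x , y) ∷ consecPairs (y ∷ r)

edges : Partition → List (ℕ × ℕ)
edges P = concatMap (λ B → consecPairs (toList B)) P

Noncrossing : Partition → Set
Noncrossing P = ∀ a b c d → (a , c) ∈ edges P → (b , d) ∈ edges P →
  a < b → b < c → c < d → ⊥

Nonnesting : Partition → Set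
Nonnesting P = ∀ a b c d → (a , d) ∈ edges P → (b , c) ∈ edges P →
  a < b → b < c → c < d → ⊥

aOf : Partition → List ℕ
aOf P = map head⁺ P

μOf : Partition → List ℕ
μOf P = map length⁺ P

-- condition (3), with a₀ = 0 and μ₀ = 1.  For i : Fin (length a) (0-based),
-- lookup a i is a_{i+1}, lookup (0 ∷ a) (inject₁ i) is a_i, and
-- sum (take (i+1) (1 ∷ μ)) = Σ_{k=0}^{i} μ_k.
Cond3 : List ℕ → List ℕ → Set
Cond3 a μ = ∀ (i : Fin (length a)) →
  (lookup (0 ∷ a) (inject₁ i) < lookup a i)
  × (lookup a i ≤ sum (take (suc (toℕ i)) (1 ∷ μ)))

Conditions : ℕ → List ℕ → List ℕ → Set
Conditions n a μ = (length a ≡ length μ) × (n ≡ sum μ) × Cond3 a μ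

-- Necessity: every element below a_i lies in one of the first i - 1 blocks, so
-- a_i - 1 ≤ μ_1 + … + μ_{i-1}.  Sufficiency: place 1, …, n in turn; an element
-- equal to the next a_i opens block i, any other one is appended to an open block
-- (one still short of its size μ_k), and condition (3) is exactly what ensures that
-- an open block exists.  Appending to the open block with the largest last element
-- (a stack) never creates a crossing, appending to the one with the smallest last
-- element (a queue) never creates a nesting.
module Submission where

open import Defs
open import Algebra.Properties.CommutativeSemigroup using (interchange)
open import Data.Empty using (⊥)
open import Data.Fin using (Fin; toℕ; inject₁) renaming (zero to fzero; suc to fsuc)
open import Data.List
  using (List; []; _∷_; _++_; _∷ʳ_; [_]; map; concat; concatMap; filter; length; upTo; take; lookup)
open import Data.List.Properties
  using ( map-++; map-∘; length-map; length-++; ++-assoc; ++-identityʳ; concatMap-++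
        ; applyUpTo-∷ʳ; length-upTo; filter-++; filter-all; filter-none; length-filter)
open import Data.List.NonEmpty using (List⁺; _∷_; toList; _⁺∷ʳ_) renaming (head to head⁺; length to length⁺)
open import Data.List.Membership.Propositional using (_∈_)
open import Data.List.Membership.Propositional.Properties
  using (∈-++⁻; ∈-++⁺ˡ; ∈-++⁺ʳ; ∈-map⁻; ∈-map⁺; ∈-upTo⁻; ∈-concat⁺′)
open import Data.List.Relation.Unary.All as All using (All; []; _∷_)
import Data.List.Relation.Unary.All.Properties as All
open import Data.List.Relation.Unary.Any using (here; there)
open import Data.List.Relation.Unary.Linked as Linked using (Linked; []; [-]; _∷_)
open import Data.List.Relation.Unary.Linked.Properties as Linkedₚ using (Linked⇒All)
open import Data.List.Relation.Binary.Permutation.Propositional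
  using (_↭_; ↭-refl; ↭-trans; ↭-reflexive; ↭-prep; module PermutationReasoning)
open import Data.List.Relation.Binary.Permutation.Propositional.Properties
  using (↭-length; ++⁺ʳ; shift; filter-↭; ∈-resp-↭; ∷↭∷ʳ)
open import Data.List.Relation.Binary.Subset.Propositional using (_⊆_)
open import Data.List.Relation.Binary.Subset.Propositional.Properties using (⊆-reflexive; ⊆-reflexive-↭)
open import Data.Nat using (ℕ; zero; suc; _+_; _<_; _≤_; _≥_; _<?_; _≟_; z≤n; s≤s; s≤s⁻¹; pred)
open import Data.Nat.Properties
open import Data.Nat.ListAction using (sum)
open import Data.Nat.ListAction.Properties using (sum-++)
open import Data.Product using (Σ; _×_; _,_; proj₁; proj₂)
open import Data.Sum using (_⊎_; inj₁; inj₂)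
open import Function using (_∘_)
open import Function.Bundles using (_⇔_; mk⇔; Equivalence)
open import Relation.Binary.PropositionalEquality
  using (_≡_; _≢_; refl; sym; trans; cong; cong₂; subst; module ≡-Reasoning)
open import Relation.Nullary using (yes; no; contradiction)

elements : Partition → List ℕ
elements P = concat (map toList P)

PartitionWith : (Partition → Set) → ℕ → List ℕ → List ℕ → Set
PartitionWith Good n a μ = Σ Partition (λ π → IsSetPartition n π × Good π × aOf π ≡ a × μOf π ≡ μ)

length-elements : ∀ P → length (elements P) ≡ sum (μOf P)
length-elements [] = refl
length-elements (B ∷ P) = trans (length-++ (toList B)) (cong (length⁺ B +_) (length-elements P))

range1-suc : ∀ n → range1 (suc n) ≡ range1 n ∷ʳ suc n
range1-suc n = trans (cong (map suc) (sym (applyUpTo-∷ʳ (λ i → i) n))) (map-++ suc (upTo n) [ n ])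

∷-range1 : ∀ n → suc n ∷ range1 n ↭ range1 (suc n)
∷-range1 n = ↭-trans (∷↭∷ʳ (suc n) (range1 n)) (↭-reflexive (sym (range1-suc n)))

length-range1 : ∀ n → length (range1 n) ≡ n
length-range1 n = trans (length-map suc (upTo n)) (length-upTo n)

∈-range1⁻ : ∀ {n y} → y ∈ range1 n → y ≤ n
∈-range1⁻ y∈ with i , i∈ , refl ← ∈-map⁻ suc y∈ = ∈-upTo⁻ i∈

length-filter-<-range1 : ∀ n {h} → h ≤ suc n → length (filter (_<? h) (range1 n)) ≡ pred h
length-filter-<-range1 zero {zero} _ = refl
length-filter-<-range1 zero {suc zero} _ = refl
length-filter-<-range1 zero {suc (suc _)} (s≤s ())
length-filter-<-range1 (suc n) {h} h≤ with m≤n⇒m<n∨m≡n h≤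
... | inj₂ refl = trans (cong length (filter-all (_<? h) (All.tabulate (s≤s ∘ ∈-range1⁻)))) (length-range1 (suc n))
... | inj₁ (s≤s h≤sn) = begin
  length (filter (_<? h) (range1 (suc n)))
    ≡⟨ cong (length ∘ filter (_<? h)) (range1-suc n) ⟩
  length (filter (_<? h) (range1 n ++ [ suc n ]))
    ≡⟨ cong length (filter-++ (_<? h) (range1 n) [ suc n ]) ⟩
  length (filter (_<? h) (range1 n) ++ filter (_<? h) [ suc n ])
    ≡⟨ cong (λ ys → length (filter (_<? h) (range1 n) ++ ys)) (filter-none (_<? h) (≤⇒≯ h≤sn ∷ [])) ⟩
  length (filter (_<? h) (range1 n) ++ [])
    ≡⟨ cong length (++-identityʳ (filter (_<? h) (range1 n))) ⟩
  length (filter (_<? h) (range1 n))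
    ≡⟨ length-filter-<-range1 n h≤sn ⟩
  pred h ∎
  where open ≡-Reasoning

-- Every element of [1, h) lies in L, so there are at least h - 1 of them.
head-bound : ∀ {n h} L R → L ++ R ↭ range1 n → All (h ≤_) R → h ∈ R → h ≤ suc (length L)
head-bound {n} {h} L R L++R↭ R≥h h∈R = pred-bound h (begin
  pred h                                       ≡⟨ length-filter-<-range1 n (m≤n⇒m≤1+n h≤n) ⟨
  length (filter (_<? h) (range1 n))           ≡⟨ ↭-length (filter-↭ (_<? h) L++R↭) ⟨
  length (filter (_<? h) (L ++ R))             ≡⟨ cong length (filter-++ (_<? h) L R) ⟩
  length (filter (_<? h) L ++ filter (_<? h) R)
    ≡⟨ cong (λ ys → length (filter (_<? h) L ++ ys)) (filter-none (_<? h) (All.map ≤⇒≯ R≥h)) ⟩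
  length (filter (_<? h) L ++ [])              ≡⟨ cong length (++-identityʳ (filter (_<? h) L)) ⟩
  length (filter (_<? h) L)                    ≤⟨ length-filter (_<? h) L ⟩
  length L                                     ∎)
  where
  open ≤-Reasoning
  h≤n : h ≤ n
  h≤n = ∈-range1⁻ (∈-resp-↭ L++R↭ (∈-++⁺ʳ L h∈R))
  pred-bound : ∀ m {k} → pred m ≤ k → m ≤ suc k
  pred-bound zero _ = z≤n
  pred-bound (suc _) le = s≤s le

-- Condition (3) relative to a previous head p and a running bound s; it
-- also forces the two lists to have equal length, i.e. condition (1).
data Admissible : ℕ → ℕ → List ℕ → List ℕ → Set where
  [] : ∀ {p s} → Admissible p s [] []
  next : ∀ {p s x m a μ} → p < x → x ≤ s → Admissible x (s + m) a μ → Admissible p s (x ∷ a) (m ∷ μ)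

Cond3From : ℕ → ℕ → List ℕ → List ℕ → Set
Cond3From p s a μ = ∀ (i : Fin (length a)) →
  (lookup (p ∷ a) (inject₁ i) < lookup a i) × (lookup a i ≤ sum (take (suc (toℕ i)) (s ∷ μ)))

admissible⇒cond3From : ∀ {p s a μ} → Admissible p s a μ → Cond3From p s a μ
admissible⇒cond3From (next p<x x≤s _) fzero = p<x , ≤-trans x≤s (m≤m+n _ 0)
admissible⇒cond3From {s = s} {μ = m ∷ μ} (next _ _ adm) (fsuc i) =
  proj₁ (admissible⇒cond3From adm i) ,
  ≤-trans (proj₂ (admissible⇒cond3From adm i)) (≤-reflexive (+-assoc s m _))

cond3From⇒admissible : ∀ {p s} a μ → length a ≡ length μ → Cond3From p s a μ → Admissible p s a μ
cond3From⇒admissible [] [] _ _ = []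
cond3From⇒admissible {s = s} (x ∷ a) (m ∷ μ) len c =
  next (proj₁ (c fzero)) (≤-trans (proj₂ (c fzero)) (≤-reflexive (+-identityʳ s)))
    (cond3From⇒admissible a μ (suc-injective len)
      (λ i → proj₁ (c (fsuc i)) , ≤-trans (proj₂ (c (fsuc i))) (≤-reflexive (sym (+-assoc s m _)))))

admissible-length : ∀ {p s a μ} → Admissible p s a μ → length a ≡ length μ
admissible-length [] = refl
admissible-length (next _ _ adm) = cong suc (admissible-length adm)

admissible-linked : ∀ {p s a μ} → Admissible p s a μ → Linked _<_ (p ∷ a)
admissible-linked [] = [-]
admissible-linked (next p<x _ adm) = p<x ∷ admissible-linked adm

conditions⇔admissible : ∀ n a μ → Conditions n a μ ⇔ (n ≡ sum μ × Admissible 0 1 a μ)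
conditions⇔admissible n a μ =
  mk⇔ (λ (len , n≡ , c3) → n≡ , cond3From⇒admissible a μ len c3)
      (λ (n≡ , adm) → admissible-length adm , n≡ , admissible⇒cond3From adm)

linked⇒all-< : ∀ {x xs} → Linked _<_ (x ∷ xs) → All (x <_) xs
linked⇒all-< [-] = []
linked⇒all-< (x<y ∷ l) = Linked⇒All <-trans x<y l

all-<-linked-∷ : ∀ {p xs} → All (p <_) xs → Linked _<_ xs → Linked _<_ (p ∷ xs)
all-<-linked-∷ [] [] = [-]
all-<-linked-∷ (p<x ∷ _) l = p<x ∷ l

elements-above : ∀ {h} P → All (Linked _<_ ∘ toList) P → All (h ≤_) (aOf P) → All (h ≤_) (elements P)
elements-above [] [] [] = []
elements-above ((x ∷ t) ∷ P) (inc ∷ incs) (h≤x ∷ h≤) =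
  All.++⁺ (h≤x ∷ All.map (λ x<y → ≤-trans h≤x (<⇒≤ x<y)) (linked⇒all-< inc)) (elements-above P incs h≤)

heads-admissible : ∀ {n} L Q p → L ++ elements Q ↭ range1 n → All (Linked _<_ ∘ toList) Q →
  Linked _<_ (p ∷ aOf Q) → Admissible p (suc (length L)) (aOf Q) (μOf Q)
heads-admissible L [] p _ _ _ = []
heads-admissible L ((h ∷ t) ∷ Q) p cover (inc ∷ incs) (p<h ∷ sorted) =
  next p<h
    (head-bound L (elements ((h ∷ t) ∷ Q)) cover
      (elements-above ((h ∷ t) ∷ Q) (inc ∷ incs) (≤-refl ∷ All.map <⇒≤ (linked⇒all-< sorted)))
      (here refl))
    (subst (λ s → Admissible h (suc s) (aOf Q) (μOf Q)) (length-++ L)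
      (heads-admissible (L ++ h ∷ t) Q h (↭-trans (↭-reflexive (++-assoc L (h ∷ t) (elements Q))) cover)
        incs sorted))

conditions-necessary : ∀ {n} π → IsSetPartition n π → All (0 <_) (aOf π) → Conditions n (aOf π) (μOf π)
conditions-necessary {n} π (inc , sorted , cover) pos =
  Equivalence.from (conditions⇔admissible n (aOf π) (μOf π))
    ( trans (sym (length-range1 n)) (trans (sym (↭-length cover)) (length-elements π))
    , heads-admissible [] π 0 cover inc (all-<-linked-∷ pos (Linkedₚ.map⁺ sorted)))

lastFrom : ℕ → List ℕ → ℕ
lastFrom x [] = x
lastFrom _ (y ∷ ys) = lastFrom y ys

lastOf : List⁺ ℕ → ℕ
lastOf (x ∷ xs) = lastFrom x xs

lastOf-∈ : ∀ x xs → lastOf (x ∷ xs) ∈ x ∷ xs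
lastOf-∈ x [] = here refl
lastOf-∈ _ (y ∷ ys) = there (lastOf-∈ y ys)

lastOf-⁺∷ʳ : ∀ x xs z → lastOf ((x ∷ xs) ⁺∷ʳ z) ≡ z
lastOf-⁺∷ʳ _ [] z = refl
lastOf-⁺∷ʳ _ (y ∷ ys) z = lastOf-⁺∷ʳ y ys z

consecPairs-⁺∷ʳ : ∀ x xs z → consecPairs (x ∷ (xs ∷ʳ z)) ≡ consecPairs (x ∷ xs) ∷ʳ (lastOf (x ∷ xs) , z)
consecPairs-⁺∷ʳ _ [] z = refl
consecPairs-⁺∷ʳ x (y ∷ ys) z = cong ((x , y) ∷_) (consecPairs-⁺∷ʳ y ys z)

linked-⁺∷ʳ : ∀ x xs {z} → Linked _<_ (x ∷ xs) → lastOf (x ∷ xs) < z → Linked _<_ (x ∷ (xs ∷ʳ z))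
linked-⁺∷ʳ _ [] _ l<z = l<z ∷ [-]
linked-⁺∷ʳ _ (y ∷ ys) (x<y ∷ inc) l<z = x<y ∷ linked-⁺∷ʳ y ys inc l<z

middle-∷ʳ-↭ : ∀ {A : Set} (xs ys zs : List A) e → xs ++ (ys ∷ʳ e) ++ zs ↭ e ∷ xs ++ ys ++ zs
middle-∷ʳ-↭ xs ys zs e = begin
  xs ++ (ys ∷ʳ e) ++ zs   ≡⟨ cong (xs ++_) (++-assoc ys [ e ] zs) ⟩
  xs ++ ys ++ [ e ] ++ zs ≡⟨ ++-assoc xs ys ([ e ] ++ zs) ⟨
  (xs ++ ys) ++ [ e ] ++ zs ↭⟨ shift e (xs ++ ys) zs ⟩
  e ∷ (xs ++ ys) ++ zs    ≡⟨ cong (e ∷_) (++-assoc xs ys zs) ⟩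
  e ∷ xs ++ ys ++ zs      ∎
  where open PermutationReasoning

concatMap-insert : ∀ {A : Set} (f : List⁺ ℕ → List A) P Q {B B′} e → f B′ ≡ f B ∷ʳ e →
  concatMap f (P ++ B′ ∷ Q) ↭ e ∷ concatMap f (P ++ B ∷ Q)
concatMap-insert f P Q {B} {B′} e fB′ = begin
  concatMap f (P ++ B′ ∷ Q)                       ≡⟨ concatMap-++ f P (B′ ∷ Q) ⟩
  concatMap f P ++ f B′ ++ concatMap f Q          ≡⟨ cong (λ ys → concatMap f P ++ ys ++ concatMap f Q) fB′ ⟩
  concatMap f P ++ (f B ∷ʳ e) ++ concatMap f Q    ↭⟨ middle-∷ʳ-↭ (concatMap f P) (f B) (concatMap f Q) e ⟩
  e ∷ concatMap f P ++ f B ++ concatMap f Q       ≡⟨ cong (e ∷_) (concatMap-++ f P (B ∷ Q)) ⟨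
  e ∷ concatMap f (P ++ B ∷ Q)                    ∎
  where open PermutationReasoning

elements-insert : ∀ P Q x xs z → elements (P ++ ((x ∷ xs) ⁺∷ʳ z) ∷ Q) ↭ z ∷ elements (P ++ (x ∷ xs) ∷ Q)
elements-insert P Q x xs z = concatMap-insert toList P Q z refl

edges-insert : ∀ P Q x xs z →
  edges (P ++ ((x ∷ xs) ⁺∷ʳ z) ∷ Q) ↭ (lastOf (x ∷ xs) , z) ∷ edges (P ++ (x ∷ xs) ∷ Q)
edges-insert P Q x xs z = concatMap-insert (consecPairs ∘ toList) P Q _ (consecPairs-⁺∷ʳ x xs z)

elements-∷ʳ : ∀ P z → elements (P ∷ʳ (z ∷ [])) ≡ elements P ∷ʳ z
elements-∷ʳ P z = concatMap-++ toList P [ z ∷ [] ]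

edges-∷ʳ : ∀ P z → edges (P ∷ʳ (z ∷ [])) ≡ edges P
edges-∷ʳ P z = trans (concatMap-++ (consecPairs ∘ toList) P [ z ∷ [] ]) (++-identityʳ (edges P))

consecPairs-∈ : ∀ {u v} xs → (u , v) ∈ consecPairs xs → u ∈ xs × v ∈ xs
consecPairs-∈ (x ∷ y ∷ r) (here refl) = here refl , there (here refl)
consecPairs-∈ (x ∷ y ∷ r) (there uv∈) with u∈ , v∈ ← consecPairs-∈ (y ∷ r) uv∈ = there u∈ , there v∈

edges-∈ : ∀ {u v} P → (u , v) ∈ edges P → u ∈ elements P × v ∈ elements P
edges-∈ (B ∷ P) uv∈ with ∈-++⁻ (consecPairs (toList B)) uv∈
... | inj₁ uv∈B with u∈ , v∈ ← consecPairs-∈ (toList B) uv∈B = ∈-++⁺ˡ u∈ , ∈-++⁺ˡ v∈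
... | inj₂ uv∈P with u∈ , v∈ ← edges-∈ P uv∈P = ∈-++⁺ʳ (toList B) u∈ , ∈-++⁺ʳ (toList B) v∈

Bounded : ℕ → List (ℕ × ℕ) → Set
Bounded t E = ∀ {u v} → (u , v) ∈ E → u ≤ t × v ≤ t

edges-bounded : ∀ {t} P → elements P ↭ range1 t → Bounded t (edges P)
edges-bounded P cover uv∈ with u∈ , v∈ ← edges-∈ P uv∈ =
  ∈-range1⁻ (∈-resp-↭ cover u∈) , ∈-range1⁻ (∈-resp-↭ cover v∈)

map-insert : ∀ {A C : Set} (f : A → C) pre post {c c′} → f c ≡ f c′ →
  map f (pre ++ c ∷ post) ≡ map f (pre ++ c′ ∷ post)
map-insert f [] post fc≡ = cong (_∷ map f post) fc≡
map-insert f (d ∷ pre) post fc≡ = cong (f d ∷_) (map-insert f pre post fc≡)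

admissible-suc : ∀ {t s x a m μ} → Admissible t s (x ∷ a) (m ∷ μ) → x ≢ suc t →
  Admissible (suc t) s (x ∷ a) (m ∷ μ)
admissible-suc (next t<x x≤s adm) x≢ = next (≤∧≢⇒< t<x (x≢ ∘ sym)) x≤s adm

-- The element that opens no block joins the open block whose last element is
-- ≼-least.  Extensible l E: an edge from l to a point beyond all of E keeps E Good.
record Discipline : Set₁ where
  field
    _≼_ : ℕ → ℕ → Set
    ≼-total : ∀ x y → x ≼ y ⊎ y ≼ x
    ≼-trans : ∀ {x y z} → x ≼ y → y ≼ z → x ≼ z
    Good : List (ℕ × ℕ) → Set
    Extensible : ℕ → List (ℕ × ℕ) → Set
    good-[] : Good []
    good-⊆ : ∀ {E F} → E ⊆ F → Good F → Good E
    extensible-⊆ : ∀ {E F l} → E ⊆ F → Extensible l F → Extensible l E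
    good-∷ : ∀ {E t l} → Bounded t E → Good E → Extensible l E → Good ((l , suc t) ∷ E)
    extensible-∷ : ∀ {E t l k} → l ≼ k → Extensible k E → Extensible k ((l , suc t) ∷ E)
    extensible-bounded : ∀ {E t} → Bounded t E → Extensible t E

module Construction (D : Discipline) where
  open Discipline D

  -- A block under construction, together with the number of elements it still lacks.
  Cell : Set
  Cell = List⁺ ℕ × ℕ

  blocks : List Cell → Partition
  blocks = map proj₁

  target : Cell → ℕ
  target (B , r) = length⁺ B + r

  missing : List Cell → ℕ
  missing cs = sum (map proj₂ cs)

  Full : Cell → Set
  Full c = proj₂ c ≡ 0

  Preferred : ℕ → Cell → Set
  Preferred l c = 0 < proj₂ c → l ≼ lastOf (proj₁ c)

  full⇒preferred : ∀ {l c} → Full c → Preferred l c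
  full⇒preferred full pos = contradiction (subst (0 <_) full pos) (<-irrefl refl)

  ExtensibleCells : List (ℕ × ℕ) → List Cell → Set
  ExtensibleCells E = All (λ c → 0 < proj₂ c → Extensible (lastOf (proj₁ c)) E)

  blocks-insert : ∀ pre post B r → blocks (pre ++ (B , r) ∷ post) ≡ blocks pre ++ B ∷ blocks post
  blocks-insert pre post B r = map-++ proj₁ pre ((B , r) ∷ post)

  elements-append : ∀ pre post x xs r z →
    elements (blocks (pre ++ ((x ∷ xs) ⁺∷ʳ z , r) ∷ post)) ↭
    z ∷ elements (blocks (pre ++ (x ∷ xs , suc r) ∷ post))
  elements-append pre post x xs r z
    rewrite blocks-insert pre post ((x ∷ xs) ⁺∷ʳ z) r | blocks-insert pre post (x ∷ xs) (suc r) =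
    elements-insert (blocks pre) (blocks post) x xs z

  edges-append : ∀ pre post x xs r z →
    edges (blocks (pre ++ ((x ∷ xs) ⁺∷ʳ z , r) ∷ post)) ⊆
    (lastOf (x ∷ xs) , z) ∷ edges (blocks (pre ++ (x ∷ xs , suc r) ∷ post))
  edges-append pre post x xs r z
    rewrite blocks-insert pre post ((x ∷ xs) ⁺∷ʳ z) r | blocks-insert pre post (x ∷ xs) (suc r) =
    ⊆-reflexive-↭ (edges-insert (blocks pre) (blocks post) x xs z)

  targets-append : ∀ pre post x xs r z →
    map target (pre ++ ((x ∷ xs) ⁺∷ʳ z , r) ∷ post) ≡ map target (pre ++ (x ∷ xs , suc r) ∷ post)
  targets-append pre post x xs r z =
    map-insert target pre post (cong suc (trans (cong (_+ r) (length-++ xs)) (+-assoc (length xs) 1 r)))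

  elements-open : ∀ cs z m → elements (blocks (cs ∷ʳ (z ∷ [] , m))) ≡ elements (blocks cs) ∷ʳ z
  elements-open cs z m = trans (cong elements (map-++ proj₁ cs [ (z ∷ [] , m) ])) (elements-∷ʳ (blocks cs) z)

  edges-open : ∀ cs z m → edges (blocks (cs ∷ʳ (z ∷ [] , m))) ≡ edges (blocks cs)
  edges-open cs z m = trans (cong edges (map-++ proj₁ cs [ (z ∷ [] , m) ])) (edges-∷ʳ (blocks cs) z)

  sum-target-open : ∀ cs z m → sum (map target (cs ∷ʳ (z ∷ [] , m))) ≡ sum (map target cs) + suc m
  sum-target-open cs z m = begin
    sum (map target (cs ∷ʳ (z ∷ [] , m))) ≡⟨ cong sum (map-++ target cs [ (z ∷ [] , m) ]) ⟩
    sum (map target cs ++ [ suc m ])     ≡⟨ sum-++ (map target cs) [ suc m ] ⟩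
    sum (map target cs) + (suc m + 0)    ≡⟨ cong (sum (map target cs) +_) (+-identityʳ (suc m)) ⟩
    sum (map target cs) + suc m          ∎
    where open ≡-Reasoning

  lastOf-∈-elements : ∀ pre post x xs r → lastOf (x ∷ xs) ∈ elements (blocks (pre ++ (x ∷ xs , r) ∷ post))
  lastOf-∈-elements pre post x xs r =
    ∈-concat⁺′ (lastOf-∈ x xs) (∈-map⁺ toList (∈-map⁺ proj₁ (∈-++⁺ʳ pre (here refl))))

  sum-target≡length+missing : ∀ cs → sum (map target cs) ≡ length (elements (blocks cs)) + missing cs
  sum-target≡length+missing [] = refl
  sum-target≡length+missing ((B , r) ∷ cs) = begin
    length⁺ B + r + sum (map target cs)
      ≡⟨ cong (length⁺ B + r +_) (sum-target≡length+missing cs) ⟩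
    length⁺ B + r + (length (elements (blocks cs)) + missing cs)
      ≡⟨ interchange +-commutativeSemigroup (length⁺ B) r _ _ ⟩
    length⁺ B + length (elements (blocks cs)) + (r + missing cs)
      ≡⟨ cong (_+ (r + missing cs)) (length-++ (toList B)) ⟨
    length (elements (blocks ((B , r) ∷ cs))) + missing ((B , r) ∷ cs) ∎
    where open ≡-Reasoning

  full⇒missing≡0 : ∀ {cs} → All Full cs → missing cs ≡ 0
  full⇒missing≡0 [] = refl
  full⇒missing≡0 (refl ∷ full) = full⇒missing≡0 full

  missing≡0⇒full : ∀ cs → missing cs ≡ 0 → All Full cs
  missing≡0⇒full [] _ = []
  missing≡0⇒full ((_ , r) ∷ cs) eq = m+n≡0⇒m≡0 r eq ∷ missing≡0⇒full cs (m+n≡0⇒n≡0 r eq)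

  lengths-full : ∀ {cs} → All Full cs → μOf (blocks cs) ≡ map target cs
  lengths-full [] = refl
  lengths-full {(B , _) ∷ _} (refl ∷ full) = cong₂ _∷_ (sym (+-identityʳ (length⁺ B))) (lengths-full full)

  record Choice (cs : List Cell) : Set where
    constructor choice
    field
      before after : List Cell
      chosen : List⁺ ℕ
      lacking : ℕ
      split : cs ≡ before ++ (chosen , suc lacking) ∷ after
      before-preferred : All (Preferred (lastOf chosen)) before
      after-preferred : All (Preferred (lastOf chosen)) after

  choose : ∀ cs → Choice cs ⊎ All Full cs
  choose [] = inj₂ []
  choose ((B , zero) ∷ cs) with choose cs
  ... | inj₂ full = inj₂ (refl ∷ full)
  ... | inj₁ (choice pre post B′ r refl p q) = inj₁ (choice ((B , zero) ∷ pre) post B′ r refl ((λ ()) ∷ p) q)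
  choose ((B , suc r) ∷ cs) with choose cs
  ... | inj₂ full = inj₁ (choice [] cs B r refl [] (All.map (λ {c} → full⇒preferred {c = c}) full))
  ... | inj₁ (choice pre post B′ r′ refl p q) with ≼-total (lastOf B) (lastOf B′)
  ...   | inj₂ B′≼B = inj₁ (choice ((B , suc r) ∷ pre) post B′ r′ refl ((λ _ → B′≼B) ∷ p) q)
  ...   | inj₁ B≼B′ = inj₁ (choice [] (pre ++ (B′ , suc r′) ∷ post) B r refl []
          (All.++⁺ (All.map (≼-trans B≼B′ ∘_) p) ((λ _ → B≼B′) ∷ All.map (≼-trans B≼B′ ∘_) q)))

  extensibleCells-⊆ : ∀ {E F} cs → E ⊆ F → ExtensibleCells F cs → ExtensibleCells E cs
  extensibleCells-⊆ cs E⊆F = All.map (λ ext pos → extensible-⊆ E⊆F (ext pos))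

  extensibleCells-∷ : ∀ {E F l t} cs → E ⊆ (l , suc t) ∷ F → All (Preferred l) cs →
    ExtensibleCells F cs → ExtensibleCells E cs
  extensibleCells-∷ cs E⊆ pref ext =
    All.zipWith (λ (p , e) pos → extensible-⊆ E⊆ (extensible-∷ (p pos) (e pos))) (pref , ext)

  module _ (n : ℕ) (a μ : List ℕ) where

    -- cs are the blocks built from 1, …, t; the blocks still to be opened have heads hs and sizes ms.
    record Invariant (t : ℕ) (cs : List Cell) (hs ms : List ℕ) : Set where
      field
        increasing : All (Linked _<_ ∘ toList ∘ proj₁) cs
        covers : elements (blocks cs) ↭ range1 t
        heads-++ : map (head⁺ ∘ proj₁) cs ++ hs ≡ a
        sizes-++ : map target cs ++ ms ≡ μ
        admissible : Admissible t (suc (sum (map target cs))) hs ms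
        extensible : ExtensibleCells (edges (blocks cs)) cs
        good : Good (edges (blocks cs))

      sum-target≡t+missing : sum (map target cs) ≡ t + missing cs
      sum-target≡t+missing = trans (sum-target≡length+missing cs)
        (cong (_+ missing cs) (trans (↭-length covers) (length-range1 t)))

    append : ∀ {t pre post x xs r hs ms} →
      Invariant t (pre ++ (x ∷ xs , suc r) ∷ post) hs ms →
      All (Preferred (lastOf (x ∷ xs))) pre → All (Preferred (lastOf (x ∷ xs))) post →
      Admissible (suc t) (suc (sum (map target (pre ++ (x ∷ xs , suc r) ∷ post)))) hs ms →
      Invariant (suc t) (pre ++ ((x ∷ xs) ⁺∷ʳ suc t , r) ∷ post) hs ms
    append {t} {pre} {post} {x} {xs} {r} {hs} {ms} inv pref-pre pref-post adm
      with inc-pre , inc-B ∷ inc-post ← All.++⁻ pre (Invariant.increasing inv)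
         | ext-pre , ext-B ∷ ext-post ← All.++⁻ pre (Invariant.extensible inv) = record
      { increasing = All.++⁺ inc-pre (linked-⁺∷ʳ x xs inc-B last<t+1 ∷ inc-post)
      ; covers = covers′
      ; heads-++ = trans (cong (_++ hs) (map-insert (head⁺ ∘ proj₁) pre post refl)) heads-++
      ; sizes-++ = trans (cong (_++ ms) (targets-append pre post x xs r (suc t))) sizes-++
      ; admissible = subst (λ s → Admissible (suc t) (suc s) hs ms)
          (sym (cong sum (targets-append pre post x xs r (suc t)))) adm
      ; extensible = All.++⁺ (extensibleCells-∷ pre edges⊆ pref-pre ext-pre)
          ((λ _ → subst (λ y → Extensible y (edges (blocks new))) (sym (lastOf-⁺∷ʳ x xs (suc t)))
                    (extensible-bounded (edges-bounded (blocks new) covers′)))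
           ∷ extensibleCells-∷ post edges⊆ pref-post ext-post)
      ; good = good-⊆ edges⊆ (good-∷ (edges-bounded (blocks old) covers) good (ext-B (s≤s z≤n)))
      }
      where
      open Invariant inv

      old new : List Cell
      old = pre ++ (x ∷ xs , suc r) ∷ post
      new = pre ++ ((x ∷ xs) ⁺∷ʳ suc t , r) ∷ post

      last<t+1 : lastOf (x ∷ xs) < suc t
      last<t+1 = s≤s (∈-range1⁻ (∈-resp-↭ covers (lastOf-∈-elements pre post x xs (suc r))))

      covers′ : elements (blocks new) ↭ range1 (suc t)
      covers′ = ↭-trans (elements-append pre post x xs r (suc t)) (↭-trans (↭-prep (suc t) covers) (∷-range1 t))

      edges⊆ : edges (blocks new) ⊆ (lastOf (x ∷ xs) , suc t) ∷ edges (blocks old)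
      edges⊆ = edges-append pre post x xs r (suc t)

    open-block : ∀ {t cs hs m ms} → Invariant t cs (suc t ∷ hs) (suc m ∷ ms) →
      Invariant (suc t) (cs ∷ʳ (suc t ∷ [] , m)) hs ms
    open-block {t} {cs} {hs} {m} {ms} inv with next _ _ adm ← Invariant.admissible inv = record
      { increasing = All.++⁺ increasing ([-] ∷ [])
      ; covers = covers′
      ; heads-++ = trans (cong (_++ hs) (map-++ (head⁺ ∘ proj₁) cs [ new ]))
          (trans (++-assoc _ [ suc t ] hs) heads-++)
      ; sizes-++ = trans (cong (_++ ms) (map-++ target cs [ new ])) (trans (++-assoc _ [ suc m ] ms) sizes-++)
      ; admissible = subst (λ s → Admissible (suc t) (suc s) hs ms) (sym (sum-target-open cs (suc t) m)) adm
      ; extensible = All.++⁺ (extensibleCells-⊆ cs (⊆-reflexive (edges-open cs (suc t) m)) extensible)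
          ((λ _ → extensible-bounded (edges-bounded (blocks (cs ∷ʳ new)) covers′)) ∷ [])
      ; good = good-⊆ (⊆-reflexive (edges-open cs (suc t) m)) good
      }
      where
      open Invariant inv

      new : Cell
      new = (suc t ∷ [] , m)

      covers′ : elements (blocks (cs ∷ʳ new)) ↭ range1 (suc t)
      covers′ = begin
        elements (blocks (cs ∷ʳ new)) ≡⟨ elements-open cs (suc t) m ⟩
        elements (blocks cs) ∷ʳ suc t ↭⟨ ++⁺ʳ [ suc t ] covers ⟩
        range1 t ∷ʳ suc t             ≡⟨ range1-suc t ⟨
        range1 (suc t)                ∎
        where open PermutationReasoning

    record Stage (t : ℕ) : Set where
      constructor stage
      field
        cells : List Cell
        heads sizes : List ℕ
        invariant : Invariant t cells heads sizes

    module _ (μ-pos : All (0 <_) μ) (n≡ : n ≡ sum μ) (adm : Admissible 0 1 a μ) where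

      sizes-positive : ∀ {t cs hs ms} → Invariant t cs hs ms → All (0 <_) ms
      sizes-positive {cs = cs} inv =
        All.++⁻ʳ (map target cs) (subst (All (0 <_)) (sym (Invariant.sizes-++ inv)) μ-pos)

      sum-target+sum-sizes≡n : ∀ {t cs hs ms} → Invariant t cs hs ms → sum (map target cs) + sum ms ≡ n
      sum-target+sum-sizes≡n {cs = cs} {ms = ms} inv =
        trans (sym (sum-++ (map target cs) ms)) (trans (cong sum (Invariant.sizes-++ inv)) (sym n≡))

      sum-target≡n : ∀ {t cs hs} → Invariant t cs hs [] → sum (map target cs) ≡ n
      sum-target≡n inv = trans (sym (+-identityʳ _)) (sum-target+sum-sizes≡n inv)

      append-step : ∀ {t cs hs ms} → Invariant t cs hs ms → t < sum (map target cs) →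
        Admissible (suc t) (suc (sum (map target cs))) hs ms → Stage (suc t)
      append-step {t} {cs} {hs} {ms} inv t<Σ adm′ with choose cs
      ... | inj₁ (choice pre post (x ∷ xs) r refl p q) = stage _ hs ms (append inv p q adm′)
      ... | inj₂ full = contradiction t<Σ (<-irrefl (sym (begin
        sum (map target cs) ≡⟨ Invariant.sum-target≡t+missing inv ⟩
        t + missing cs      ≡⟨ cong (t +_) (full⇒missing≡0 full) ⟩
        t + 0               ≡⟨ +-identityʳ t ⟩
        t                   ∎)))
        where open ≡-Reasoning

      -- If t + 1 is not the next head, condition (3) guarantees an open block for it.
      step : ∀ {t} → t < n → Stage t → Stage (suc t)
      step {t} t<n (stage cs hs ms inv) with Invariant.admissible inv
      ... | [] = append-step inv (subst (t <_) (sym (sum-target≡n inv)) t<n) []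
      ... | next {x = x} t<x x≤s adm′ with x ≟ suc t
      ...   | no x≢ = append-step inv (s≤s⁻¹ (≤-trans (≤∧≢⇒< t<x (x≢ ∘ sym)) x≤s))
                        (admissible-suc (Invariant.admissible inv) x≢)
      ...   | yes refl with sizes-positive inv
      ...     | s≤s z≤n ∷ _ = stage _ _ _ (open-block inv)

      initial : Stage 0
      initial = stage [] a μ (record
        { increasing = []
        ; covers = ↭-refl
        ; heads-++ = refl
        ; sizes-++ = refl
        ; admissible = adm
        ; extensible = []
        ; good = good-[]
        })

      stage-at : ∀ t → t ≤ n → Stage t
      stage-at zero _ = initial
      stage-at (suc t) t<n = step t<n (stage-at t (<⇒≤ t<n))

      final : Stage n → PartitionWith (Good ∘ edges) n a μ
      final (stage cs hs ms inv) with Invariant.admissible inv | sizes-positive inv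
      ... | next n<x x≤s _ | m>0 ∷ _ = contradiction n<x (≤⇒≯ (≤-trans x≤s Σ<n))
        where
        Σ<n : sum (map target cs) < n
        Σ<n = subst (sum (map target cs) <_) (sum-target+sum-sizes≡n inv) (m<m+n _ (≤-trans m>0 (m≤m+n _ _)))
      ... | [] | [] =
        blocks cs ,
        (All.map⁺ increasing , Linkedₚ.map⁻ (subst (Linked _<_) (sym heads≡) a-increasing) , covers) ,
        good , heads≡ ,
        trans (lengths-full (missing≡0⇒full cs missing≡0)) (trans (sym (++-identityʳ _)) sizes-++)
        where
        open Invariant inv
        a-increasing : Linked _<_ a
        a-increasing = Linked.tail (admissible-linked adm)
        heads≡ : aOf (blocks cs) ≡ a
        heads≡ = trans (sym (map-∘ cs)) (trans (sym (++-identityʳ _)) heads-++)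
        missing≡0 : missing cs ≡ 0
        missing≡0 = +-cancelˡ-≡ n (missing cs) 0 (begin
          n + missing cs      ≡⟨ sum-target≡t+missing ⟨
          sum (map target cs) ≡⟨ sum-target≡n inv ⟩
          n                   ≡⟨ +-identityʳ n ⟨
          n + 0               ∎)
          where open ≡-Reasoning

      construct : PartitionWith (Good ∘ edges) n a μ
      construct = final (stage-at n ≤-refl)

NoncrossingEdges : List (ℕ × ℕ) → Set
NoncrossingEdges E = ∀ a b c d → (a , c) ∈ E → (b , d) ∈ E → a < b → b < c → c < d → ⊥

NonnestingEdges : List (ℕ × ℕ) → Set
NonnestingEdges E = ∀ a b c d → (a , d) ∈ E → (b , c) ∈ E → a < b → b < c → c < d → ⊥

Unstraddled : ℕ → List (ℕ × ℕ) → Set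
Unstraddled l E = ∀ {a c} → (a , c) ∈ E → a < l → l < c → ⊥

NoneStartAfter : ℕ → List (ℕ × ℕ) → Set
NoneStartAfter l E = ∀ {b c} → (b , c) ∈ E → l < b → ⊥

noncrossing-∷ : ∀ {E t l} → Bounded t E → NoncrossingEdges E → Unstraddled l E →
  NoncrossingEdges ((l , suc t) ∷ E)
noncrossing-∷ _ _ _ a b c d (here refl) (here refl) a<b _ _ = <-irrefl refl a<b
noncrossing-∷ bd _ _ a b c d (here refl) (there bd∈) _ _ c<d = ≤⇒≯ (proj₂ (bd bd∈)) (<-trans (n<1+n _) c<d)
noncrossing-∷ _ _ u a b c d (there ac∈) (here refl) a<b b<c _ = u ac∈ a<b b<c
noncrossing-∷ _ nc _ a b c d (there ac∈) (there bd∈) = nc a b c d ac∈ bd∈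

nonnesting-∷ : ∀ {E t l} → Bounded t E → NonnestingEdges E → NoneStartAfter l E →
  NonnestingEdges ((l , suc t) ∷ E)
nonnesting-∷ _ _ _ a b c d (here refl) (here refl) a<b _ _ = <-irrefl refl a<b
nonnesting-∷ _ _ s a b c d (here refl) (there bc∈) a<b _ _ = s bc∈ a<b
nonnesting-∷ bd _ _ a b c d (there ad∈) (here refl) _ _ c<d = ≤⇒≯ (proj₂ (bd ad∈)) (<-trans (n<1+n _) c<d)
nonnesting-∷ _ nn _ a b c d (there ad∈) (there bc∈) = nn a b c d ad∈ bc∈

noncrossing : Discipline
noncrossing = record
  { _≼_ = _≥_
  ; ≼-total = λ x y → ≤-total y x
  ; ≼-trans = λ y≤x z≤y → ≤-trans z≤y y≤x
  ; Good = NoncrossingEdges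
  ; Extensible = Unstraddled
  ; good-[] = λ _ _ _ _ ()
  ; good-⊆ = λ E⊆F nc a b c d ac∈ bd∈ → nc a b c d (E⊆F ac∈) (E⊆F bd∈)
  ; extensible-⊆ = λ E⊆F u ac∈ → u (E⊆F ac∈)
  ; good-∷ = noncrossing-∷
  ; extensible-∷ = λ { k≤l u (here refl) l<k _ → ≤⇒≯ k≤l l<k ; _ u (there ac∈) → u ac∈ }
  ; extensible-bounded = λ bd ac∈ _ t<c → ≤⇒≯ (proj₂ (bd ac∈)) t<c
  }

nonnesting : Discipline
nonnesting = record
  { _≼_ = _≤_
  ; ≼-total = ≤-total
  ; ≼-trans = ≤-trans
  ; Good = NonnestingEdges
  ; Extensible = NoneStartAfter
  ; good-[] = λ _ _ _ _ ()
  ; good-⊆ = λ E⊆F nn a b c d ad∈ bc∈ → nn a b c d (E⊆F ad∈) (E⊆F bc∈)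
  ; extensible-⊆ = λ E⊆F s bc∈ → s (E⊆F bc∈)
  ; good-∷ = nonnesting-∷
  ; extensible-∷ = λ { l≤k s (here refl) k<l → ≤⇒≯ l≤k k<l ; _ s (there bc∈) → s bc∈ }
  ; extensible-bounded = λ bd bc∈ t<b → ≤⇒≯ (proj₁ (bd bc∈)) t<b
  }

corollary2p5 : (n : ℕ) (a μ : List ℕ) → 0 < n → All (0 <_) a → All (0 <_) μ →
    ((Σ Partition (λ π → IsSetPartition n π × Noncrossing π × aOf π ≡ a × μOf π ≡ μ)) ⇔ Conditions n a μ)
    × ((Σ Partition (λ π → IsSetPartition n π × Nonnesting π × aOf π ≡ a × μOf π ≡ μ)) ⇔ Conditions n a μ)
corollary2p5 n a μ _ a-pos μ-pos =
  mk⇔ necessary (sufficient noncrossing) , mk⇔ necessary (sufficient nonnesting)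
  where
  necessary : ∀ {Good} → PartitionWith Good n a μ → Conditions n a μ
  necessary (π , partition , _ , refl , refl) = conditions-necessary π partition a-pos

  sufficient : (D : Discipline) → Conditions n a μ → PartitionWith (Discipline.Good D ∘ edges) n a μ
  sufficient D conditions =
    let n≡ , adm = Equivalence.to (conditions⇔admissible n a μ) conditions
    in Construction.construct D n a μ μ-pos n≡ adm
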